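{- Let $(y_0,m_0,d_0)\in G_0$. Set $q_1=y_0/100$, $y_c=1461\cdot y_0/4-q_1+q_1/4$, $m_c=(979\cdot m_0-2919)/2^5$ and $d_c=d_0$. Then $\rho_0(y_0,m_0,d_0)=y_c+m_c+d_c$.
   Context: For $n,\delta\in\mathbb{Z}$ with $\delta\neq0$, $n/\delta$ and $n\%\delta$ denote Euclidean quotient and remainder ($n=q\delta+s$, $0\le s<|\delta|$); $\cdot$, $/$, $\%$ have equal precedence and associate left to right. $\mathbb{Z}^3$ carries the lexicographic order. A year $y$ is a leap year if ($y\%4=0$ and $y\%100\ne0$) or $y\%400=0$. The Gregorian calendar is $G=\{(y,m,d)\in\mathbb{Z}^3: m\in\{1,\dots,12\},\ 1\le d\le L(y,m)\}$ where $L(y,m)=31$ for $m\in\{1,3,5,7,8,10,12\}$, $L(y,m)=30$ for $m\in\{4,6,9,11\}$, and $L(y,2)=29$ if $y$ is a leap year and $28$ otherwise. Let $P_1:\mathbb{Z}^3\to\mathbb{Z}^3$, $P_1(y,m,d)=(y-\mathbf 1_{\{m\le2\}},\ m+12\cdot\mathbf 1_{\{m\le2\}},\ d-1)$, where $\mathbf 1_{\{P\}}$ is $1$ if $P$ holds and $0$ otherwise. The computational calendar is $G_0=\{P_1(x): x\in G,\ P_1(x)\ge e_0\}$ with $e_0=(0,3,0)$, and $\rho_0:G_0\to\mathbb{Z}$ is $\rho_0(x)=\#\{z\in G_0: e_0\le z<x\}$. -}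

module Defs where

open import Data.Integer.Base using (ℤ; +_; _+_; _-_; _*_; _/_; _%_; _<_; _≤_; _≤ᵇ_)
open import Data.Nat.Base using (ℕ)
open import Data.Bool.Base using (if_then_else_)
open import Data.Product using (Σ; ∃; _×_; _,_)
open import Data.Sum using (_⊎_)
open import Data.List using (List; length)
open import Data.List.Membership.Propositional using (_∈_)
open import Data.List.Relation.Unary.Unique.Propositional using (Unique)
open import Relation.Nullary using (¬_)
open import Relation.Binary.PropositionalEquality using (_≡_; _≢_)

ℤ³ : Set
ℤ³ = ℤ × ℤ × ℤ

_<ₗ_ : ℤ³ → ℤ³ → Set
(a₁ , a₂ , a₃) <ₗ (b₁ , b₂ , b₃) =
  (a₁ < b₁) ⊎ ((a₁ ≡ b₁) × ((a₂ < b₂) ⊎ ((a₂ ≡ b₂) × (a₃ < b₃))))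

_≤ₗ_ : ℤ³ → ℤ³ → Set
a ≤ₗ b = (a <ₗ b) ⊎ (a ≡ b)

-- Leap year (Euclidean remainder, as in Data.Integer.Base._%_)
LeapYear : ℤ → Set
LeapYear y = ((y % + 4 ≡ 0) × (y % + 100 ≢ 0)) ⊎ (y % + 400 ≡ 0)

data ThirtyOne : ℤ → Set where
  m1 : ThirtyOne (+ 1)
  m3 : ThirtyOne (+ 3)
  m5 : ThirtyOne (+ 5)
  m7 : ThirtyOne (+ 7)
  m8 : ThirtyOne (+ 8)
  m10 : ThirtyOne (+ 10)
  m12 : ThirtyOne (+ 12)

data Thirty : ℤ → Set where
  m4 : Thirty (+ 4)
  m6 : Thirty (+ 6)
  m9 : Thirty (+ 9)
  m11 : Thirty (+ 11)

data MonthLength : ℤ → ℤ → ℤ → Set where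
  len31 : ∀ {y m} → ThirtyOne m → MonthLength y m (+ 31)
  len30 : ∀ {y m} → Thirty m → MonthLength y m (+ 30)
  lenFebLeap : ∀ {y} → LeapYear y → MonthLength y (+ 2) (+ 29)
  lenFebCommon : ∀ {y} → ¬ LeapYear y → MonthLength y (+ 2) (+ 28)

InG : ℤ³ → Set
InG (y , m , d) = (+ 1 ≤ m) × (m ≤ + 12) × (+ 1 ≤ d) × (∃ λ l → MonthLength y m l × (d ≤ l))

𝟙≤2 : ℤ → ℤ
𝟙≤2 m = if m ≤ᵇ + 2 then + 1 else + 0

P₁ : ℤ³ → ℤ³
P₁ (y , m , d) = (y - 𝟙≤2 m , m + + 12 * 𝟙≤2 m , d - + 1)

e₀ : ℤ³
e₀ = (+ 0 , + 3 , + 0)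

InG₀ : ℤ³ → Set
InG₀ z = ∃ λ x → InG x × (P₁ x ≡ z) × (e₀ ≤ₗ P₁ x)

-- ρ₀ x = n  :  the set {z ∈ G₀ : e₀ ≤ z < x} is finite of cardinality n,
-- witnessed by a duplicate-free list enumerating exactly that set.
HasCount : ℤ³ → ℕ → Set
HasCount x n = Σ (List ℤ³) λ zs →
  Unique zs × (∀ z → (z ∈ zs → InG₀ z × e₀ ≤ₗ z × z <ₗ x)
                   × (InG₀ z × e₀ ≤ₗ z × z <ₗ x → z ∈ zs))
               × (length zs ≡ n)

-- Starting the year in March puts February, and with it the leap day, at the end of the
-- year. Coding a day of G₀ as (y, m − 3, d) ∈ ℕ³, the days of G₀ before it are those of the
-- years 0, …, y − 1, those of the first m − 3 months of year y and d more, each listed once.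
-- Year y has 365 + [y + 1 is leap] days; since [n is leap] + [100 ∣ n] = [4 ∣ n] + [400 ∣ n]
-- and ⌊n / k⌋ grows by [k ∣ n + 1] from n to n + 1, the first y years have
-- 365 y + ⌊y/4⌋ − ⌊y/100⌋ + ⌊y/400⌋ = ⌊1461 y / 4⌋ − q + ⌊q/4⌋ days, q = ⌊y/100⌋.
-- The months are checked one by one against ⌊(979 m − 2919) / 32⌋.
module Submission where

module Calendar where

  open import Data.Bool.Base using (if_then_else_)
  open import Data.Empty using (⊥-elim)
  open import Data.Integer.Base as ℤ using (ℤ; +_; +≤+; +<+)
  open import Data.Integer.DivMod using (div-pos-is-/ℕ)
  open import Data.Integer.Properties using (pos-*; +-injective)
  import Data.Integer.Tactic.RingSolver as ℤ-Solver
  open import Data.List.Base using (List; []; _++_; map; upTo; length)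
  open import Data.List.Membership.Propositional using (_∈_)
  open import Data.List.Membership.Propositional.Properties
    using (∈-map⁺; ∈-map⁻; ∈-++⁺ˡ; ∈-++⁺ʳ; ∈-++⁻; ∈-upTo⁺; ∈-upTo⁻)
  open import Data.List.Properties using (length-++; length-map; length-upTo)
  open import Data.List.Relation.Binary.Disjoint.Propositional using (Disjoint)
  open import Data.List.Relation.Unary.Unique.Propositional using (Unique)
  open import Data.List.Relation.Unary.Unique.Propositional.Properties using (++⁺; map⁺; upTo⁺)
  open import Data.List.Relation.Unary.AllPairs using ([])
  open import Data.Nat.Base
  open import Data.Nat.DivMod
  open import Data.Nat.Divisibility using (_∣_; _∣?_; divides; n∣m*n; ∣-trans; m%n≡0⇒n∣m; n∣m⇒m%n≡0)
  open import Data.Nat.Properties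
  open import Data.Nat.Tactic.RingSolver using (solve-∀)
  open import Data.Product.Base using (∃; _×_; _,_; proj₁; proj₂)
  open import Data.Sum.Base using (inj₁; inj₂)
  open import Function.Base using (_∘_)
  open import Level using (Level)
  open import Relation.Binary.PropositionalEquality
  open import Relation.Nullary.Decidable using (Dec; does; yes; no; _×-dec_; _⊎-dec_; ¬?; dec-true; dec-false)
  open import Relation.Nullary.Negation using (¬_)
  open import Defs

  private variable
    a : Level
    A B C : Set a

  𝟙 : Dec A → ℕ
  𝟙 a? = if does a? then 1 else 0

  𝟙-yes : (a? : Dec A) → A → 𝟙 a? ≡ 1
  𝟙-yes a? x rewrite dec-true a? x = refl

  𝟙-no : (a? : Dec A) → ¬ A → 𝟙 a? ≡ 0
  𝟙-no a? ¬x rewrite dec-false a? ¬x = refl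

  𝟙-inclusion-exclusion : (a? : Dec A) (b? : Dec B) (c? : Dec C) → (C → B) → (B → A) →
    𝟙 ((a? ×-dec ¬? b?) ⊎-dec c?) + 𝟙 b? ≡ 𝟙 a? + 𝟙 c?
  𝟙-inclusion-exclusion (yes _) (yes _) (yes _) _   _   = refl
  𝟙-inclusion-exclusion (yes _) (yes _) (no _)  _   _   = refl
  𝟙-inclusion-exclusion (yes _) (no ¬b) (yes c) c⇒b _   = ⊥-elim (¬b (c⇒b c))
  𝟙-inclusion-exclusion (yes _) (no _)  (no _)  _   _   = refl
  𝟙-inclusion-exclusion (no ¬a) (yes b) _       _   b⇒a = ⊥-elim (¬a (b⇒a b))
  𝟙-inclusion-exclusion (no _)  (no ¬b) (yes c) c⇒b _   = ⊥-elim (¬b (c⇒b c))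
  𝟙-inclusion-exclusion (no _)  (no _)  (no _)  _   _   = refl

  [1+m]%d≡[1+m%d]%d : ∀ m d .{{_ : NonZero d}} → suc m % d ≡ suc (m % d) % d
  [1+m]%d≡[1+m%d]%d m d =
    trans (cong (λ k → suc k % d) (m≡m%n+[m/n]*n m d)) ([m+kn]%n≡m%n (suc (m % d)) (m / d) d)

  [1+m%d]/d≡[d∣1+m] : ∀ m d .{{_ : NonZero d}} → suc (m % d) / d ≡ 𝟙 (d ∣? suc m)
  [1+m%d]/d≡[d∣1+m] m d with m≤n⇒m<n∨m≡n (m%n<n m d)
  ... | inj₁ 1+r<d = trans (m<n⇒m/n≡0 1+r<d) (sym (𝟙-no (d ∣? suc m) d∤1+m))
    where
    d∤1+m : ¬ d ∣ suc m
    d∤1+m d∣1+m = 0≢1+n (begin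
      0                ≡⟨ n∣m⇒m%n≡0 (suc m) d d∣1+m ⟨
      suc m % d        ≡⟨ [1+m]%d≡[1+m%d]%d m d ⟩
      suc (m % d) % d  ≡⟨ m<n⇒m%n≡m 1+r<d ⟩
      suc (m % d)      ∎)
      where open ≡-Reasoning
  ... | inj₂ 1+r≡d = trans (/-congˡ 1+r≡d) (trans (n/n≡1 d) (sym (𝟙-yes (d ∣? suc m) d∣1+m)))
    where
    d∣1+m : d ∣ suc m
    d∣1+m = m%n≡0⇒n∣m (suc m) d (trans ([1+m]%d≡[1+m%d]%d m d) (trans (%-congˡ 1+r≡d) (n%n≡0 d)))

  /-suc : ∀ m d .{{_ : NonZero d}} → suc m / d ≡ m / d + 𝟙 (d ∣? suc m)
  /-suc m d = begin
    suc m / d                        ≡⟨ /-congˡ (cong suc (m≡m%n+[m/n]*n m d)) ⟩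
    (suc (m % d) + m / d * d) / d    ≡⟨ +-distrib-/-∣ʳ (suc (m % d)) (n∣m*n (m / d)) ⟩
    suc (m % d) / d + m / d * d / d  ≡⟨ cong₂ _+_ ([1+m%d]/d≡[d∣1+m] m d) (m*n/n≡m (m / d) d) ⟩
    𝟙 (d ∣? suc m) + m / d           ≡⟨ +-comm _ (m / d) ⟩
    m / d + 𝟙 (d ∣? suc m)           ∎
    where open ≡-Reasoning

  1461y/4≡365y+y/4 : ∀ y → 1461 * y / 4 ≡ 365 * y + y / 4
  1461y/4≡365y+y/4 y = begin
    1461 * y / 4             ≡⟨ /-congˡ (split y) ⟩
    (y + 365 * y * 4) / 4    ≡⟨ +-distrib-/-∣ʳ y (n∣m*n (365 * y)) ⟩
    y / 4 + 365 * y * 4 / 4  ≡⟨ cong (λ t → y / 4 + t) (m*n/n≡m (365 * y) 4) ⟩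
    y / 4 + 365 * y          ≡⟨ +-comm (y / 4) (365 * y) ⟩
    365 * y + y / 4          ∎
    where
    open ≡-Reasoning
    split : ∀ y → 1461 * y ≡ y + 365 * y * 4
    split = solve-∀

  leapYear? : (y : ℤ) → Dec (LeapYear y)
  leapYear? y = ((y ℤ.% + 4 ≟ 0) ×-dec ¬? (y ℤ.% + 100 ≟ 0)) ⊎-dec (y ℤ.% + 400 ≟ 0)

  leapDays : ℕ → ℕ
  leapDays n = 𝟙 (leapYear? (+ n))

  leapDays-inclusion-exclusion : ∀ n → leapDays n + 𝟙 (100 ∣? n) ≡ 𝟙 (4 ∣? n) + 𝟙 (400 ∣? n)
  -- leapYear? (+ n) and the decisions k ∣? n both compute n % k ≡ᵇ 0, so this is literally an
  -- instance of 𝟙-inclusion-exclusion.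
  leapDays-inclusion-exclusion n = 𝟙-inclusion-exclusion (4 ∣? n) (100 ∣? n) (400 ∣? n)
    (∣-trans (divides 4 refl)) (∣-trans (divides 25 refl))

  february-length : ∀ {y} (leap? : Dec (LeapYear y)) → MonthLength y (+ 2) (+ (28 + 𝟙 leap?))
  february-length (yes leap)   = lenFebLeap leap
  february-length (no common)  = lenFebCommon common

  february-length⁻ : ∀ {y l} (leap? : Dec (LeapYear y)) → MonthLength y (+ 2) l → l ≡ + (28 + 𝟙 leap?)
  february-length⁻ (yes _)      (lenFebLeap _)        = refl
  february-length⁻ (no common)  (lenFebLeap leap)     = ⊥-elim (common leap)
  february-length⁻ (yes leap)   (lenFebCommon common) = ⊥-elim (common leap)
  february-length⁻ (no _)       (lenFebCommon _)      = refl

  -- Month j of year y is Gregorian month j + 3, months 13 and 14 being January and February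
  -- of year y + 1; the junk value 0 for j ≥ 12 makes every day of such a month invalid.
  monthLength : ℕ → ℕ → ℕ
  monthLength y 0  = 31
  monthLength y 1  = 30
  monthLength y 2  = 31
  monthLength y 3  = 30
  monthLength y 4  = 31
  monthLength y 5  = 31
  monthLength y 6  = 30
  monthLength y 7  = 31
  monthLength y 8  = 30
  monthLength y 9  = 31
  monthLength y 10 = 31
  monthLength y 11 = 28 + leapDays (suc y)
  monthLength y _  = 0

  monthLength-pos⇒<12 : ∀ y j → 0 < monthLength y j → j < 12
  monthLength-pos⇒<12 y j pos with 12 ≤? j
  ... | no 12≰j = ≰⇒> 12≰j
  ... | yes 12≤j with k , refl ← m≤n⇒∃[o]m+o≡n 12≤j = ⊥-elim (n≮0 pos)

  march-to-december-length : ∀ {a j l} y → MonthLength a (+ (3 + j)) (+ l) → l ≡ monthLength y j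
  march-to-december-length y (len31 m3)  = refl
  march-to-december-length y (len30 m4)  = refl
  march-to-december-length y (len31 m5)  = refl
  march-to-december-length y (len30 m6)  = refl
  march-to-december-length y (len31 m7)  = refl
  march-to-december-length y (len31 m8)  = refl
  march-to-december-length y (len30 m9)  = refl
  march-to-december-length y (len31 m10) = refl
  march-to-december-length y (len30 m11) = refl
  march-to-december-length y (len31 m12) = refl

  sum< : ℕ → (ℕ → ℕ) → ℕ
  sum< zero    f = 0
  sum< (suc n) f = sum< n f + f n

  daysBeforeMonth : ℕ → ℕ → ℕ
  daysBeforeMonth y j = sum< j (monthLength y)

  daysBeforeYear : ℕ → ℕ
  daysBeforeYear y = sum< y (λ y′ → daysBeforeMonth y′ 12)

  daysBeforeYear-count : ∀ y → daysBeforeYear y + y / 100 ≡ 365 * y + y / 4 + y / 400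
  daysBeforeYear-count zero    = refl
  daysBeforeYear-count (suc y) = begin
    -- the twelve month lengths of year y add up to 365 + leapDays (suc y) by computation
    daysBeforeYear y + (365 + leapDays (suc y)) + suc y / 100
      ≡⟨ cong (λ t → daysBeforeYear y + (365 + leapDays (suc y)) + t) (/-suc y 100) ⟩
    daysBeforeYear y + (365 + leapDays (suc y)) + (y / 100 + 𝟙 (100 ∣? suc y))
      ≡⟨ regroup₁ (daysBeforeYear y) (leapDays (suc y)) (y / 100) (𝟙 (100 ∣? suc y)) ⟩
    (daysBeforeYear y + y / 100) + 365 + (leapDays (suc y) + 𝟙 (100 ∣? suc y))
      ≡⟨ cong₂ (λ s t → s + 365 + t) (daysBeforeYear-count y) (leapDays-inclusion-exclusion (suc y)) ⟩
    (365 * y + y / 4 + y / 400) + 365 + (𝟙 (4 ∣? suc y) + 𝟙 (400 ∣? suc y))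
      ≡⟨ regroup₂ y (y / 4) (y / 400) (𝟙 (4 ∣? suc y)) (𝟙 (400 ∣? suc y)) ⟩
    365 * suc y + (y / 4 + 𝟙 (4 ∣? suc y)) + (y / 400 + 𝟙 (400 ∣? suc y))
      ≡⟨ cong₂ (λ s t → 365 * suc y + s + t) (/-suc y 4) (/-suc y 400) ⟨
    365 * suc y + suc y / 4 + suc y / 400 ∎
    where
    open ≡-Reasoning
    regroup₁ : ∀ a l q b → a + (365 + l) + (q + b) ≡ (a + q) + 365 + (l + b)
    regroup₁ = solve-∀
    regroup₂ : ∀ y q q′ b b′ → 365 * y + q + q′ + 365 + (b + b′) ≡ 365 * suc y + (q + b) + (q′ + b′)
    regroup₂ = solve-∀

  /-pos : ∀ n d .{{_ : NonZero d}} → + n ℤ./ + d ≡ + (n / d)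
  /-pos n d = div-pos-is-/ℕ (+ n) d

  a-c+b≡d : ∀ {a b c d} → d + c ≡ a + b → + a ℤ.- + c ℤ.+ + b ≡ + d
  a-c+b≡d {a} {b} {c} {d} d+c≡a+b = begin
    + a ℤ.- + c ℤ.+ + b  ≡⟨ regroup (+ a) (+ b) (+ c) ⟩
    + (a + b) ℤ.- + c    ≡⟨ cong (λ t → + t ℤ.- + c) d+c≡a+b ⟨
    + (d + c) ℤ.- + c    ≡⟨ cancel (+ d) (+ c) ⟩
    + d                  ∎
    where
    open ≡-Reasoning
    regroup : ∀ a b c → a ℤ.- c ℤ.+ b ≡ a ℤ.+ b ℤ.- c
    regroup = ℤ-Solver.solve-∀
    cancel : ∀ d c → d ℤ.+ c ℤ.- c ≡ d
    cancel = ℤ-Solver.solve-∀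

  daysBeforeYear-formula : ∀ y →
    (+ 1461 ℤ.* + y) ℤ./ + 4 ℤ.- + y ℤ./ + 100 ℤ.+ (+ y ℤ./ + 100) ℤ./ + 4 ≡ + daysBeforeYear y
  daysBeforeYear-formula y = begin
    (+ 1461 ℤ.* + y) ℤ./ + 4 ℤ.- + y ℤ./ + 100 ℤ.+ (+ y ℤ./ + 100) ℤ./ + 4
      ≡⟨ cong₂ (λ p q → p ℤ.- q ℤ.+ q ℤ./ + 4)
               (trans (cong (λ t → t ℤ./ + 4) (sym (pos-* 1461 y))) (/-pos (1461 * y) 4)) (/-pos y 100) ⟩
    + (1461 * y / 4) ℤ.- + (y / 100) ℤ.+ + (y / 100) ℤ./ + 4
      ≡⟨ cong (λ r → + (1461 * y / 4) ℤ.- + (y / 100) ℤ.+ r) (/-pos (y / 100) 4) ⟩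
    + (1461 * y / 4) ℤ.- + (y / 100) ℤ.+ + (y / 100 / 4)
      ≡⟨ a-c+b≡d (begin
         daysBeforeYear y + y / 100  ≡⟨ daysBeforeYear-count y ⟩
         365 * y + y / 4 + y / 400   ≡⟨ cong₂ _+_ (1461y/4≡365y+y/4 y) (m/n/o≡m/[n*o] y 100 4) ⟨
         1461 * y / 4 + y / 100 / 4  ∎) ⟩
    + daysBeforeYear y ∎
    where open ≡-Reasoning

  daysBeforeMonth-formula : ∀ y j {d} → d < monthLength y j →
    (+ 979 ℤ.* + (3 + j) ℤ.- + 2919) ℤ./ + 32 ≡ + daysBeforeMonth y j
  daysBeforeMonth-formula y 0  _ = refl
  daysBeforeMonth-formula y 1  _ = refl
  daysBeforeMonth-formula y 2  _ = refl
  daysBeforeMonth-formula y 3  _ = refl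
  daysBeforeMonth-formula y 4  _ = refl
  daysBeforeMonth-formula y 5  _ = refl
  daysBeforeMonth-formula y 6  _ = refl
  daysBeforeMonth-formula y 7  _ = refl
  daysBeforeMonth-formula y 8  _ = refl
  daysBeforeMonth-formula y 9  _ = refl
  daysBeforeMonth-formula y 10 _ = refl
  daysBeforeMonth-formula y 11 _ = refl
  daysBeforeMonth-formula y (suc (suc (suc (suc (suc (suc (suc (suc (suc (suc (suc (suc _)))))))))))) ()

  separated⇒disjoint : ∀ {xs ys : List A} (key : A → ℕ) {k} →
    (∀ {x} → x ∈ xs → key x < k) → (∀ {x} → x ∈ ys → key x ≡ k) → Disjoint xs ys
  separated⇒disjoint key xs<k ys≡k (x∈xs , x∈ys) = <-irrefl (ys≡k x∈ys) (xs<k x∈xs)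

  module _ (f : ℕ → List A) where

    blocks : ℕ → List A
    blocks zero    = []
    blocks (suc n) = blocks n ++ f n

    length-blocks : ∀ {g} → (∀ i → length (f i) ≡ g i) → ∀ n → length (blocks n) ≡ sum< n g
    length-blocks len-f zero    = refl
    length-blocks len-f (suc n) = trans (length-++ (blocks n)) (cong₂ _+_ (length-blocks len-f n) (len-f n))

    module _ (key : A → ℕ) (key-f : ∀ {i x} → x ∈ f i → key x ≡ i) where

      ∈-blocks⁻ : ∀ {n x} → x ∈ blocks n → key x < n × x ∈ f (key x)
      ∈-blocks⁻ {suc n} x∈ with ∈-++⁻ (blocks n) x∈
      ... | inj₁ x∈blocks = let key<n , x∈f = ∈-blocks⁻ x∈blocks in m<n⇒m<1+n key<n , x∈f
      ... | inj₂ x∈fn rewrite key-f x∈fn = n<1+n n , x∈fn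

      ∈-blocks⁺ : ∀ {n x} → key x < n → x ∈ f (key x) → x ∈ blocks n
      ∈-blocks⁺ {suc n} key<1+n x∈f with m<1+n⇒m<n∨m≡n key<1+n
      ... | inj₁ key<n = ∈-++⁺ˡ (∈-blocks⁺ key<n x∈f)
      ... | inj₂ key≡n = ∈-++⁺ʳ (blocks n) (subst (λ i → _ ∈ f i) key≡n x∈f)

      blocks-unique : (∀ i → Unique (f i)) → ∀ n → Unique (blocks n)
      blocks-unique f-unique zero    = []
      blocks-unique f-unique (suc n) = ++⁺ (blocks-unique f-unique n) (f-unique n)
        (separated⇒disjoint key (λ x∈ → proj₁ (∈-blocks⁻ x∈)) key-f)

  Day : Set
  Day = ℕ × ℕ × ℕ

  year month : Day → ℕ
  year  (y , _ , _) = y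
  month (_ , j , _) = j

  ValidDay : Day → Set
  ValidDay (y , j , d) = d < monthLength y j

  toℤ³ : Day → ℤ³
  toℤ³ (y , j , d) = + y , + (3 + j) , + d

  toℤ³-injective : ∀ {u v} → toℤ³ u ≡ toℤ³ v → u ≡ v
  toℤ³-injective {_ , _ , _} {_ , _ , _} refl = refl

  dayBlock : ℕ → ℕ → ℕ → List Day
  dayBlock y j k = map (λ d → y , j , d) (upTo k)

  ∈-dayBlock⁻ : ∀ {y j k u} → u ∈ dayBlock y j k → ∃ λ d → d < k × u ≡ (y , j , d)
  ∈-dayBlock⁻ u∈ with d , d∈ , refl ← ∈-map⁻ _ u∈ = d , ∈-upTo⁻ d∈ , refl

  ∈-dayBlock⁺ : ∀ {y j k d} → d < k → (y , j , d) ∈ dayBlock y j k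
  ∈-dayBlock⁺ d<k = ∈-map⁺ _ (∈-upTo⁺ d<k)

  dayBlock-unique : ∀ y j k → Unique (dayBlock y j k)
  dayBlock-unique y j k = map⁺ (cong (λ u → proj₂ (proj₂ u))) (upTo⁺ k)

  length-dayBlock : ∀ y j k → length (dayBlock y j k) ≡ k
  length-dayBlock y j k = trans (length-map _ (upTo k)) (length-upTo k)

  monthBlock : ℕ → ℕ → List Day
  monthBlock y j = dayBlock y j (monthLength y j)

  ∈-monthBlock⁻ : ∀ {y j u} → u ∈ monthBlock y j → year u ≡ y × month u ≡ j × ValidDay u
  ∈-monthBlock⁻ u∈ with _ , d< , refl ← ∈-dayBlock⁻ u∈ = refl , refl , d<

  monthsBefore : ℕ → ℕ → List Day
  monthsBefore y = blocks (monthBlock y)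

  ∈-monthsBefore⁻ : ∀ {y n u} → u ∈ monthsBefore y n → year u ≡ y × month u < n × ValidDay u
  ∈-monthsBefore⁻ {y} u∈ =
    let j<n , u∈month = ∈-blocks⁻ (monthBlock y) month (proj₁ ∘ proj₂ ∘ ∈-monthBlock⁻) u∈
        y≡ , _ , valid = ∈-monthBlock⁻ u∈month
    in y≡ , j<n , valid

  ∈-monthsBefore⁺ : ∀ {y n j d} → j < n → ValidDay (y , j , d) → (y , j , d) ∈ monthsBefore y n
  ∈-monthsBefore⁺ {y} j<n valid =
    ∈-blocks⁺ (monthBlock y) month (proj₁ ∘ proj₂ ∘ ∈-monthBlock⁻) j<n (∈-dayBlock⁺ valid)

  monthsBefore-unique : ∀ y n → Unique (monthsBefore y n)
  monthsBefore-unique y =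
    blocks-unique (monthBlock y) month (proj₁ ∘ proj₂ ∘ ∈-monthBlock⁻) (λ j → dayBlock-unique y j _)

  length-monthsBefore : ∀ y n → length (monthsBefore y n) ≡ daysBeforeMonth y n
  length-monthsBefore y = length-blocks (monthBlock y) (λ j → length-dayBlock y j _)

  yearBlock : ℕ → List Day
  yearBlock y = monthsBefore y 12

  yearsBefore : ℕ → List Day
  yearsBefore = blocks yearBlock

  year-yearBlock : ∀ {y u} → u ∈ yearBlock y → year u ≡ y
  year-yearBlock = proj₁ ∘ ∈-monthsBefore⁻ {n = 12}

  ∈-yearsBefore⁻ : ∀ {n u} → u ∈ yearsBefore n → year u < n × ValidDay u
  ∈-yearsBefore⁻ u∈ =
    let y<n , u∈year = ∈-blocks⁻ yearBlock year year-yearBlock u∈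
    in y<n , proj₂ (proj₂ (∈-monthsBefore⁻ {n = 12} u∈year))

  ∈-yearsBefore⁺ : ∀ {n y j d} → y < n → ValidDay (y , j , d) → (y , j , d) ∈ yearsBefore n
  ∈-yearsBefore⁺ {j = j} y<n valid = ∈-blocks⁺ yearBlock year year-yearBlock y<n
    (∈-monthsBefore⁺ (monthLength-pos⇒<12 _ j (≤-<-trans z≤n valid)) valid)

  yearsBefore-unique : ∀ n → Unique (yearsBefore n)
  yearsBefore-unique = blocks-unique yearBlock year year-yearBlock (λ y → monthsBefore-unique y 12)

  length-yearsBefore : ∀ n → length (yearsBefore n) ≡ daysBeforeYear n
  length-yearsBefore = length-blocks yearBlock (λ y → length-monthsBefore y 12)

  daysBefore : Day → List Day
  daysBefore (y , j , d) = yearsBefore y ++ monthsBefore y j ++ dayBlock y j d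

  ∈-daysBefore⁻ : ∀ {x u} → ValidDay x → u ∈ daysBefore x → ValidDay u × toℤ³ u <ₗ toℤ³ x
  ∈-daysBefore⁻ {y , j , d} {a , b , c} valid u∈ with ∈-++⁻ (yearsBefore y) u∈
  ... | inj₁ u∈years = let a<y , valid-u = ∈-yearsBefore⁻ u∈years in valid-u , inj₁ (+<+ a<y)
  ... | inj₂ u∈rest with ∈-++⁻ (monthsBefore y j) u∈rest
  ...   | inj₁ u∈months with refl , b<j , valid-u ← ∈-monthsBefore⁻ {y} u∈months =
    valid-u , inj₂ (refl , inj₁ (+<+ (+-monoʳ-< 3 b<j)))
  ...   | inj₂ u∈days with _ , c<d , refl ← ∈-dayBlock⁻ u∈days =
    <-trans c<d valid , inj₂ (refl , inj₂ (refl , +<+ c<d))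

  ∈-daysBefore⁺ : ∀ {x u} → ValidDay u → toℤ³ u <ₗ toℤ³ x → u ∈ daysBefore x
  ∈-daysBefore⁺ {y , j , d} {a , b , c} valid (inj₁ (+<+ a<y)) = ∈-++⁺ˡ (∈-yearsBefore⁺ a<y valid)
  ∈-daysBefore⁺ {y , j , d} {a , b , c} valid (inj₂ (refl , inj₁ (+<+ 3+b<3+j))) =
    ∈-++⁺ʳ (yearsBefore y) (∈-++⁺ˡ (∈-monthsBefore⁺ (+-cancelˡ-< 3 b j 3+b<3+j) valid))
  ∈-daysBefore⁺ {y , j , d} {a , b , c} valid (inj₂ (refl , inj₂ (refl , +<+ c<d))) =
    ∈-++⁺ʳ (yearsBefore y) (∈-++⁺ʳ (monthsBefore y j) (∈-dayBlock⁺ c<d))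

  daysBefore-unique : ∀ x → Unique (daysBefore x)
  daysBefore-unique (y , j , d) =
    ++⁺ (yearsBefore-unique y)
        (++⁺ (monthsBefore-unique y j) (dayBlock-unique y j d)
             (separated⇒disjoint month (proj₁ ∘ proj₂ ∘ ∈-monthsBefore⁻) month-dayBlock))
        (separated⇒disjoint year (proj₁ ∘ ∈-yearsBefore⁻) year-rest)
    where
    month-dayBlock : ∀ {u} → u ∈ dayBlock y j d → month u ≡ j
    month-dayBlock u∈ with _ , _ , refl ← ∈-dayBlock⁻ u∈ = refl
    year-rest : ∀ {u} → u ∈ monthsBefore y j ++ dayBlock y j d → year u ≡ y
    year-rest u∈ with ∈-++⁻ (monthsBefore y j) u∈
    ... | inj₁ u∈months = proj₁ (∈-monthsBefore⁻ {y} {j} u∈months)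
    ... | inj₂ u∈days with _ , _ , refl ← ∈-dayBlock⁻ u∈days = refl

  length-daysBefore : ∀ y j d → length (daysBefore (y , j , d)) ≡ daysBeforeYear y + daysBeforeMonth y j + d
  length-daysBefore y j d = begin
    length (yearsBefore y ++ monthsBefore y j ++ dayBlock y j d)
      ≡⟨ length-++ (yearsBefore y) ⟩
    length (yearsBefore y) + length (monthsBefore y j ++ dayBlock y j d)
      ≡⟨ cong (λ t → length (yearsBefore y) + t) (length-++ (monthsBefore y j)) ⟩
    length (yearsBefore y) + (length (monthsBefore y j) + length (dayBlock y j d))
      ≡⟨ cong₂ (λ s t → s + (t + length (dayBlock y j d))) (length-yearsBefore y) (length-monthsBefore y j) ⟩
    daysBeforeYear y + (daysBeforeMonth y j + length (dayBlock y j d))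
      ≡⟨ cong (λ t → daysBeforeYear y + (daysBeforeMonth y j + t)) (length-dayBlock y j d) ⟩
    daysBeforeYear y + (daysBeforeMonth y j + d)
      ≡⟨ +-assoc (daysBeforeYear y) _ d ⟨
    daysBeforeYear y + daysBeforeMonth y j + d ∎
    where open ≡-Reasoning

  e₀≤toℤ³ : ∀ u → e₀ ≤ₗ toℤ³ u
  e₀≤toℤ³ (suc y , j     , d)     = inj₁ (inj₁ (+<+ (s≤s z≤n)))
  e₀≤toℤ³ (zero  , suc j , d)     = inj₁ (inj₂ (refl , inj₁ (+<+ (m≤m+n 4 j))))
  e₀≤toℤ³ (zero  , zero  , suc d) = inj₁ (inj₂ (refl , inj₂ (refl , +<+ (s≤s z≤n))))
  e₀≤toℤ³ (zero  , zero  , zero)  = inj₂ refl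

  InG-intro : ∀ {y m d l} → 1 ≤ m → m ≤ 12 → MonthLength y (+ m) (+ l) → d < l → InG (y , + m , + suc d)
  InG-intro 1≤m m≤12 len d<l = +≤+ 1≤m , +≤+ m≤12 , +≤+ (s≤s z≤n) , _ , len , +≤+ d<l

  InG₀-intro : ∀ x u → InG x → P₁ x ≡ toℤ³ u → InG₀ (toℤ³ u)
  InG₀-intro x u x∈G P₁x≡u = x , x∈G , P₁x≡u , subst (e₀ ≤ₗ_) (sym P₁x≡u) (e₀≤toℤ³ u)

  march-to-december : ∀ {y j d} → 3 + j ≤ 12 → MonthLength (+ y) (+ (3 + j)) (+ monthLength y j) →
    ValidDay (y , j , d) → InG₀ (toℤ³ (y , j , d))
  march-to-december {y} {j} {d} ≤12 len valid =
    InG₀-intro (+ y , + (3 + j) , + suc d) _ (InG-intro (s≤s z≤n) ≤12 len valid)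
      (cong₂ _,_ (cong +_ (+-identityʳ y)) (cong₂ _,_ (cong +_ (+-identityʳ (3 + j))) refl))

  ValidDay⇒InG₀ : ∀ u → ValidDay u → InG₀ (toℤ³ u)
  ValidDay⇒InG₀ (y , 0  , d) = march-to-december (m≤m+n 3 9) (len31 m3)
  ValidDay⇒InG₀ (y , 1  , d) = march-to-december (m≤m+n 4 8) (len30 m4)
  ValidDay⇒InG₀ (y , 2  , d) = march-to-december (m≤m+n 5 7) (len31 m5)
  ValidDay⇒InG₀ (y , 3  , d) = march-to-december (m≤m+n 6 6) (len30 m6)
  ValidDay⇒InG₀ (y , 4  , d) = march-to-december (m≤m+n 7 5) (len31 m7)
  ValidDay⇒InG₀ (y , 5  , d) = march-to-december (m≤m+n 8 4) (len31 m8)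
  ValidDay⇒InG₀ (y , 6  , d) = march-to-december (m≤m+n 9 3) (len30 m9)
  ValidDay⇒InG₀ (y , 7  , d) = march-to-december (m≤m+n 10 2) (len31 m10)
  ValidDay⇒InG₀ (y , 8  , d) = march-to-december (m≤m+n 11 1) (len30 m11)
  ValidDay⇒InG₀ (y , 9  , d) = march-to-december ≤-refl (len31 m12)
  ValidDay⇒InG₀ (y , 10 , d) valid =
    InG₀-intro (+ suc y , + 1 , + suc d) _ (InG-intro ≤-refl (m≤m+n 1 11) (len31 m1) valid) refl
  ValidDay⇒InG₀ (y , 11 , d) valid =
    InG₀-intro (+ suc y , + 2 , + suc d) _
      (InG-intro (m≤m+n 1 1) (m≤m+n 2 10) (february-length (leapYear? (+ suc y))) valid) refl
  ValidDay⇒InG₀ (y , suc (suc (suc (suc (suc (suc (suc (suc (suc (suc (suc (suc _))))))))))) , d) ()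

  e₀≤ₗ⇒nonneg : ∀ {y m d} → e₀ ≤ₗ (y , m , d) → ∃ λ n → y ≡ + n
  e₀≤ₗ⇒nonneg (inj₁ (inj₁ (+<+ {n = n} _))) = n , refl
  e₀≤ₗ⇒nonneg (inj₁ (inj₂ (refl , _)))     = 0 , refl
  e₀≤ₗ⇒nonneg (inj₂ refl)                  = 0 , refl

  y-1≡+n⇒y≡+[1+n] : ∀ {y n} → y ℤ.- + 1 ≡ + n → y ≡ + suc n
  y-1≡+n⇒y≡+[1+n] {+ suc m} y-1≡n = cong (λ k → + suc k) (+-injective y-1≡n)

  P₁⇒ValidDay : ∀ y {k d l} → MonthLength y (+ k) (+ l) → d < l → e₀ ≤ₗ P₁ (y , + k , + suc d) →
    ∃ λ u → P₁ (y , + k , + suc d) ≡ toℤ³ u × ValidDay u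
  P₁⇒ValidDay y {1} {d} (len31 m1) d<31 e₀≤ with n , y-1≡n ← e₀≤ₗ⇒nonneg e₀≤ =
    (n , 10 , d) , cong₂ _,_ y-1≡n refl , d<31
  P₁⇒ValidDay y {2} {d} len d<l e₀≤ with e₀≤ₗ⇒nonneg e₀≤
  ... | n , y-1≡n with refl ← y-1≡+n⇒y≡+[1+n] {y} y-1≡n =
    (n , 11 , d) , cong₂ _,_ y-1≡n refl ,
    subst (d <_) (+-injective (february-length⁻ (leapYear? (+ suc n)) len)) d<l
  P₁⇒ValidDay y {suc (suc (suc j))} {d} len d<l e₀≤ with n , y≡n ← e₀≤ₗ⇒nonneg e₀≤ =
    (n , j , d) , cong₂ _,_ y≡n (cong₂ _,_ (cong +_ (+-identityʳ (3 + j))) refl) ,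
    subst (d <_) (march-to-december-length n len) d<l

  InG₀⇒ValidDay : ∀ {z} → InG₀ z → ∃ λ u → z ≡ toℤ³ u × ValidDay u
  InG₀⇒ValidDay ((y , _ , _) , (+≤+ _ , _ , +≤+ {n = suc d} _ , _ , len , +≤+ d<l) , refl , e₀≤) =
    P₁⇒ValidDay y len d<l e₀≤

  daysBefore-count : ∀ x → ValidDay x → HasCount (toℤ³ x) (length (daysBefore x))
  daysBefore-count x valid =
    map toℤ³ (daysBefore x) , map⁺ toℤ³-injective (daysBefore-unique x) ,
    (λ _ → sound , complete) , length-map toℤ³ (daysBefore x)
    where
    sound : ∀ {z} → z ∈ map toℤ³ (daysBefore x) → InG₀ z × e₀ ≤ₗ z × z <ₗ toℤ³ x
    sound z∈ with u , u∈ , refl ← ∈-map⁻ toℤ³ z∈ =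
      let valid-u , u<x = ∈-daysBefore⁻ valid u∈ in ValidDay⇒InG₀ u valid-u , e₀≤toℤ³ u , u<x
    complete : ∀ {z} → InG₀ z × e₀ ≤ₗ z × z <ₗ toℤ³ x → z ∈ map toℤ³ (daysBefore x)
    complete (z∈G₀ , _ , z<x) with u , refl , valid-u ← InG₀⇒ValidDay z∈G₀ =
      ∈-map⁺ toℤ³ (∈-daysBefore⁺ valid-u z<x)

open Calendar
open import Defs
open import Data.Integer.Base using (ℤ; +_; _+_; _-_; _*_; _/_)
open import Data.List.Base using (length)
import Data.Nat.Base as ℕ
open import Data.Product using (∃; _×_; _,_)
open import Relation.Binary.PropositionalEquality using (_≡_; refl; cong; cong₂; module ≡-Reasoning)

corollary2 : (y₀ m₀ d₀ : ℤ) → InG₀ (y₀ , m₀ , d₀) →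
    ∃ λ n → HasCount (y₀ , m₀ , d₀) n ×
      (+ n ≡ (((+ 1461 * y₀) / + 4 - (y₀ / + 100)) + (y₀ / + 100) / + 4)
             + (+ 979 * m₀ - + 2919) / + 32
             + d₀)
corollary2 _ _ _ z∈G₀ with (y , j , d) , refl , valid ← InG₀⇒ValidDay z∈G₀ =
  length (daysBefore (y , j , d)) , daysBefore-count (y , j , d) valid , (begin
    + length (daysBefore (y , j , d))
      ≡⟨ cong +_ (length-daysBefore y j d) ⟩
    + daysBeforeYear y + + daysBeforeMonth y j + + d
      ≡⟨ cong₂ (λ s t → s + t + + d) (daysBeforeYear-formula y) (daysBeforeMonth-formula y j valid) ⟨
    (+ 1461 * + y) / + 4 - + y / + 100 + (+ y / + 100) / + 4 + (+ 979 * + (3 ℕ.+ j) - + 2919) / + 32 + + d ∎)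
  where open ≡-Reasoning
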